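{- For fixed non-zero $z, q \in \mathbb{C}$ and all integers $h \geq 0$, the numerator convergent function $P_h(q,z)$ defined in the context satisfies $$P_h(q,z) = \sum_{0 \leq n < h}\left(\sum_{0 \leq i \leq n} \begin{bmatrix} h \\ i \end{bmatrix}_{q^2} q^{(2h-1)i}(-1)^i q^{(n-i)^2}\right) z^n.$$
   Context: For a fixed non-zero $q \in \mathbb{C}$ define, for integers $h \geq 0$, $c_h(q) = q^{2h-3}(q^{2h}+q^{2h-2}-1)$ if $h \geq 2$, $c_1(q) = q$, $c_0(q) = 1$; and $\alpha_h(q) = q^{6h-10}(q^{2h-2}-1)$ if $h \geq 2$, $\alpha_h(q)=0$ otherwise. Define $P_0(q,z)=0$, $P_1(q,z)=1$, and for $h \geq 2$: $P_h(q,z) = (1-c_h(q) z)P_{h-1}(q,z) - \alpha_h(q) z^2 P_{h-2}(q,z)$. The $q$-Pochhammer symbol is $(a;q)_n = \prod_{j=0}^{n-1}(1-aq^j)$ for $n \geq 1$ and $(a;q)_0=1$. The $q$-binomial coefficient is $\begin{bmatrix} n \\ m \end{bmatrix}_q = \frac{(q;q)_n}{(q;q)_m (q;q)_{n-m}}$ for $0 \leq m \leq n$, and $0$ otherwise; $\begin{bmatrix} n \\ m \end{bmatrix}_{q^2}$ denotes this with $q$ replaced by $q^2$. -}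

module Defs where

open import Level using (Level)
open import Data.Nat using (ℕ; zero; suc; _∸_) renaming (_+_ to _+ℕ_; _*_ to _*ℕ_)
open import Algebra.Bundles using (CommutativeRing; Semiring)
import Algebra.Definitions.RawSemiring as RawSemiringDefs

module _ {c ℓ : Level} (R : CommutativeRing c ℓ) where
  open CommutativeRing R
  open RawSemiringDefs (Semiring.rawSemiring semiring) using (_^_)

  sumBelow : ℕ → (ℕ → Carrier) → Carrier
  sumBelow zero    f = 0#
  sumBelow (suc n) f = sumBelow n f + f n

  qBinom : Carrier → ℕ → ℕ → Carrier
  qBinom Q n       zero    = 1#
  qBinom Q zero    (suc m) = 0#
  qBinom Q (suc n) (suc m) = qBinom Q n m + (Q ^ suc m) * qBinom Q n (suc m)

  cCoef : Carrier → ℕ → Carrier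
  cCoef q zero          = 1#
  cCoef q (suc zero)    = q
  -- h = k+2 : q^(2h-3) (q^(2h) + q^(2h-2) - 1)
  cCoef q (suc (suc k)) =
    (q ^ (2 *ℕ k +ℕ 1)) * ((q ^ (2 *ℕ k +ℕ 4)) + (q ^ (2 *ℕ k +ℕ 2)) - 1#)

  αCoef : Carrier → ℕ → Carrier
  αCoef q zero          = 0#
  αCoef q (suc zero)    = 0#
  -- h = k+2 : q^(6h-10) (q^(2h-2) - 1)
  αCoef q (suc (suc k)) = (q ^ (6 *ℕ k +ℕ 2)) * ((q ^ (2 *ℕ k +ℕ 2)) - 1#)

  P : Carrier → Carrier → ℕ → Carrier
  P q z zero          = 0#
  P q z (suc zero)    = 1#
  P q z (suc (suc k)) =
    (1# - cCoef q (suc (suc k)) * z) * P q z (suc k)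
    - αCoef q (suc (suc k)) * (z ^ 2) * P q z k

  rhs : Carrier → Carrier → ℕ → Carrier
  rhs q z h = sumBelow h (λ n →
    sumBelow (suc n) (λ i →
      qBinom (q ^ 2) h i * (q ^ ((2 *ℕ h ∸ 1) *ℕ i)) * ((- 1#) ^ i)
        * (q ^ ((n ∸ i) *ℕ (n ∸ i))))
    * (z ^ n))

-- The right-hand side is the truncation to degree < h of the product of
-- B_h(z) = Σ_i [h,i]_{q²} (-q^(2h-1) z)^i and θ(z) = Σ_m q^(m²) z^m.
-- Using the q-Pascal rule together with the ratio [k,i+1]/[k,i], one checks
-- coefficientwise that B_{k+2} = (1 - c z) B_{k+1} - α z² B_k; multiplying by θ
-- keeps this recurrence, and truncating keeps it as well, because the
-- coefficient of z^h in B_h θ is q^(h²) Σ_i [h,i]_{q²} q^(i(i-1)) (-1)^i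
-- = q^(h²) ∏_{j<h} (1 - q^(2j)) = 0.  Hence both sides satisfy the recurrence
-- defining P_h, with the same initial values.  This is a polynomial identity,
-- valid in every commutative ring.
{-# OPTIONS --safe #-}
module Submission where

open import Defs
open import Data.Nat using (ℕ)
open import Relation.Nullary using (¬_)
open import Algebra.Bundles using (CommutativeRing)

module ExponentArithmetic where
  open import Data.Nat.Base
  open import Data.Nat.Properties using (+-suc; +-assoc; +-comm; +-cancelʳ-≡; m+[n∸m]≡n; *-zeroʳ)
  open import Data.Nat.Tactic.RingSolver using (solve; solve-∀)
  open import Data.List.Base using (_∷_; [])
  open import Relation.Binary.PropositionalEquality
  open ≡-Reasoning

  2*[1+k]∸1≡1+2*k : ∀ k → 2 * suc k ∸ 1 ≡ suc (2 * k)
  2*[1+k]∸1≡1+2*k k = +-suc k (k + 0)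

  -- The hypothesis j ≤ k excludes k = 0 < j, where 2 * k ∸ 1 truncates.
  [2k∸1]j+j≡2kj : ∀ {j k} → j ≤ k → (2 * k ∸ 1) * j + j ≡ 2 * k * j
  [2k∸1]j+j≡2kj {k = zero}  z≤n = refl
  [2k∸1]j+j≡2kj {j} {suc k} _   = begin
    (2 * suc k ∸ 1) * j + j  ≡⟨ cong (λ e → e * j + j) (2*[1+k]∸1≡1+2*k k) ⟩
    suc (2 * k) * j + j      ≡⟨ solve (j ∷ k ∷ []) ⟩
    2 * suc k * j            ∎

  m+j≡2kj+n⇒m≡[2k∸1]j+n : ∀ {j k} m n → j ≤ k → m + j ≡ 2 * k * j + n → m ≡ (2 * k ∸ 1) * j + n
  m+j≡2kj+n⇒m≡[2k∸1]j+n {j} {k} m n j≤k m+j≡ = +-cancelʳ-≡ j m _ (begin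
    m + j                          ≡⟨ m+j≡ ⟩
    2 * k * j + n                  ≡⟨ cong (_+ n) ([2k∸1]j+j≡2kj j≤k) ⟨
    (2 * k ∸ 1) * j + j + n        ≡⟨ +-assoc ((2 * k ∸ 1) * j) j n ⟩
    (2 * k ∸ 1) * j + (j + n)      ≡⟨ cong ((2 * k ∸ 1) * j +_) (+-comm j n) ⟩
    (2 * k ∸ 1) * j + (n + j)      ≡⟨ +-assoc ((2 * k ∸ 1) * j) n j ⟨
    (2 * k ∸ 1) * j + n + j        ∎)

  exponent₂₂ : ∀ {j k} → j ≤ k →
    (2 * suc (suc k) ∸ 1) * suc (suc j) ≡ (2 * k ∸ 1) * j + (2 * (j * 2 + k * 2 + 3) + 0)
  exponent₂₂ {j} {k} j≤k = m+j≡2kj+n⇒m≡[2k∸1]j+n _ _ j≤k (begin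
    (2 * suc (suc k) ∸ 1) * suc (suc j) + j  ≡⟨ cong (λ e → e * suc (suc j) + j) (2*[1+k]∸1≡1+2*k (suc k)) ⟩
    suc (2 * suc k) * suc (suc j) + j        ≡⟨ solve (j ∷ k ∷ []) ⟩
    2 * k * j + (2 * (j * 2 + k * 2 + 3) + 0) ∎)

  exponent₁₂ : ∀ {j k} → j ≤ k →
    (2 * suc k ∸ 1) * suc (suc j) ≡ (2 * k ∸ 1) * j + (2 * (j * 1 + k * 2 + 1) + 0)
  exponent₁₂ {j} {k} j≤k = m+j≡2kj+n⇒m≡[2k∸1]j+n _ _ j≤k (begin
    (2 * suc k ∸ 1) * suc (suc j) + j        ≡⟨ cong (λ e → e * suc (suc j) + j) (2*[1+k]∸1≡1+2*k k) ⟩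
    suc (2 * k) * suc (suc j) + j            ≡⟨ solve (j ∷ k ∷ []) ⟩
    2 * k * j + (2 * (j * 1 + k * 2 + 1) + 0) ∎)

  exponent₁₁ : ∀ {j k} → j ≤ k →
    (2 * suc k ∸ 1) * suc j ≡ (2 * k ∸ 1) * j + (2 * (j * 1 + k * 1 + 0) + 1)
  exponent₁₁ {j} {k} j≤k = m+j≡2kj+n⇒m≡[2k∸1]j+n _ _ j≤k (begin
    (2 * suc k ∸ 1) * suc j + j              ≡⟨ cong (λ e → e * suc j + j) (2*[1+k]∸1≡1+2*k k) ⟩
    suc (2 * k) * suc j + j                  ≡⟨ solve (j ∷ k ∷ []) ⟩
    2 * k * j + (2 * (j * 1 + k * 1 + 0) + 1) ∎)

  [1+i]i≡i[i∸1]+2i : ∀ i → suc i * i ≡ i * (i ∸ 1) + 2 * i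
  [1+i]i≡i[i∸1]+2i zero    = refl
  [1+i]i≡i[i∸1]+2i (suc i) = begin
    suc (suc i) * suc i      ≡⟨ solve (i ∷ []) ⟩
    suc i * i + 2 * suc i    ∎

  diagonal-exponent : ∀ {i n} → i ≤ n → (2 * n ∸ 1) * i + (n ∸ i) * (n ∸ i) ≡ n * n + i * (i ∸ 1)
  diagonal-exponent {zero} {n} _ = begin
    (2 * n ∸ 1) * 0 + n * n  ≡⟨ cong (_+ n * n) (*-zeroʳ (2 * n ∸ 1)) ⟩
    n * n                    ≡⟨ +-comm 0 (n * n) ⟩
    n * n + 0                ∎
  diagonal-exponent {suc i} {suc n} (s≤s i≤n) = begin
    (2 * suc n ∸ 1) * suc i + d * d        ≡⟨ cong (λ e → e * suc i + d * d) (2*[1+k]∸1≡1+2*k n) ⟩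
    suc (2 * n) * suc i + d * d            ≡⟨ cong (λ m → suc (2 * m) * suc i + d * d) (m+[n∸m]≡n i≤n) ⟨
    suc (2 * (i + d)) * suc i + d * d      ≡⟨ expand i d ⟩
    suc (i + d) * suc (i + d) + suc i * i  ≡⟨ cong (λ m → suc m * suc m + suc i * i) (m+[n∸m]≡n i≤n) ⟩
    suc n * suc n + suc i * i              ∎
    where
    d : ℕ
    d = n ∸ i
    expand : ∀ i d → suc (2 * (i + d)) * suc i + d * d ≡ suc (i + d) * suc (i + d) + suc i * i
    expand = solve-∀

  [2[1+k]∸1]*1≡2k+1 : ∀ k → (2 * suc k ∸ 1) * 1 ≡ 2 * k + 1
  [2[1+k]∸1]*1≡2k+1 k = begin
    (2 * suc k ∸ 1) * 1  ≡⟨ cong (_* 1) (2*[1+k]∸1≡1+2*k k) ⟩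
    suc (2 * k) * 1      ≡⟨ solve (k ∷ []) ⟩
    2 * k + 1            ∎

  6k+2≡2[3k]+2 : ∀ k → 6 * k + 2 ≡ 2 * (k * 3) + 2
  6k+2≡2[3k]+2 = solve-∀

-- The ring solver for an arbitrary commutative ring, with coefficients in ℤ
-- (where equality is decidable) interpreted through fromℤ.
module IntegerCoefficientSolver {c ℓ} (R : CommutativeRing c ℓ) where
  open import Data.Maybe.Base using (Maybe; just; nothing)
  open import Data.Nat.Base as ℕ using (zero; suc)
  open import Data.Nat.Properties using (+-suc)
  open import Data.Integer.Base as ℤ using (ℤ; +_; -[1+_]; _⊖_; _◃_; sign; ∣_∣; +-*-rawRing)
  open import Data.Integer.Properties using ([1+m]⊖[1+n]≡m⊖n; _≟_)
  open import Data.Sign.Base as Sign using (Sign)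
  open import Relation.Nullary.Decidable using (yes; no)
  open import Relation.Binary.PropositionalEquality.Core as ≡ using (cong)
  open import Algebra.Solver.Ring.AlmostCommutativeRing
    using (fromCommutativeRing; _-Raw-AlmostCommutative⟶_)

  open CommutativeRing R
  open import Algebra.Properties.Ring ring using (-1*x≈-x; -‿involutive; -‿+-comm; -0#≈0#)
  open import Algebra.Properties.Semiring.Mult.TCOptimised semiring using (_×_; 1+×; ×-homo-+; ×1-homo-*)
  open import Algebra.Properties.CommutativeSemigroup *-commutativeSemigroup using (interchange)
  open import Relation.Binary.Reasoning.Setoid setoid

  -- This _×_ has 1 × x = x, so that con (+ 1) evaluates to 1# definitionally.
  fromℤ : ℤ → Carrier
  fromℤ (+ n)      = n × 1#
  fromℤ (-[1+ n ]) = - (suc n × 1#)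

  fromSign : Sign → Carrier
  fromSign Sign.+ = 1#
  fromSign Sign.- = - 1#

  ⊖-homo : ∀ m n → fromℤ (m ⊖ n) ≈ m × 1# - n × 1#
  ⊖-homo zero    zero    = sym (-‿inverseʳ 0#)
  ⊖-homo (suc m) zero    = sym (trans (+-congˡ -0#≈0#) (+-identityʳ _))
  ⊖-homo zero    (suc n) = sym (+-identityˡ _)
  ⊖-homo (suc m) (suc n) = begin
    fromℤ (suc m ⊖ suc n)           ≡⟨ cong fromℤ ([1+m]⊖[1+n]≡m⊖n m n) ⟩
    fromℤ (m ⊖ n)                   ≈⟨ ⊖-homo m n ⟩
    m × 1# - n × 1#                 ≈⟨ cancel-1# (m × 1#) (n × 1#) ⟨
    (1# + m × 1#) - (1# + n × 1#)   ≈⟨ +-cong (1+× m 1#) (-‿cong (1+× n 1#)) ⟨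
    suc m × 1# - suc n × 1#         ∎
    where
    cancel-1# : ∀ a b → (1# + a) - (1# + b) ≈ a - b
    cancel-1# a b = begin
      (1# + a) - (1# + b)     ≈⟨ +-cong (+-comm a 1#) (-‿+-comm 1# b) ⟨
      (a + 1#) + (- 1# - b)   ≈⟨ +-assoc a 1# _ ⟩
      a + (1# + (- 1# - b))   ≈⟨ +-congˡ (+-assoc 1# (- 1#) (- b)) ⟨
      a + ((1# - 1#) - b)     ≈⟨ +-congˡ (+-congʳ (-‿inverseʳ 1#)) ⟩
      a + (0# - b)            ≈⟨ +-congˡ (+-identityˡ (- b)) ⟩
      a - b                   ∎

  +-homo : ∀ i j → fromℤ (i ℤ.+ j) ≈ fromℤ i + fromℤ j
  +-homo (+ m)    (+ n)    = ×-homo-+ 1# m n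
  +-homo (+ m)    -[1+ n ] = ⊖-homo m (suc n)
  +-homo -[1+ m ] (+ n)    = trans (⊖-homo n (suc m)) (+-comm _ _)
  +-homo -[1+ m ] -[1+ n ] = begin
    - (suc (suc (m ℕ.+ n)) × 1#)    ≡⟨ cong (λ k → - (k × 1#)) (+-suc (suc m) n) ⟨
    - ((suc m ℕ.+ suc n) × 1#)      ≈⟨ -‿cong (×-homo-+ 1# (suc m) (suc n)) ⟩
    - (suc m × 1# + suc n × 1#)     ≈⟨ -‿+-comm _ _ ⟨
    - (suc m × 1#) - suc n × 1#     ∎

  -‿homo : ∀ i → fromℤ (ℤ.- i) ≈ - fromℤ i
  -‿homo (+ zero)  = sym -0#≈0#
  -‿homo (+ suc n) = refl
  -‿homo -[1+ n ]  = sym (-‿involutive _)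

  ◃-homo : ∀ s n → fromℤ (s ◃ n) ≈ fromSign s * (n × 1#)
  ◃-homo s      zero    = sym (zeroʳ _)
  ◃-homo Sign.+ (suc n) = sym (*-identityˡ _)
  ◃-homo Sign.- (suc n) = sym (-1*x≈-x _)

  sign*abs : ∀ i → fromSign (sign i) * (∣ i ∣ × 1#) ≈ fromℤ i
  sign*abs (+ n)    = *-identityˡ _
  sign*abs -[1+ n ] = -1*x≈-x _

  sign-*-homo : ∀ s t → fromSign (s Sign.* t) ≈ fromSign s * fromSign t
  sign-*-homo Sign.+ t      = sym (*-identityˡ _)
  sign-*-homo Sign.- Sign.+ = sym (*-identityʳ _)
  sign-*-homo Sign.- Sign.- = sym (trans (-1*x≈-x (- 1#)) (-‿involutive 1#))

  *-homo : ∀ i j → fromℤ (i ℤ.* j) ≈ fromℤ i * fromℤ j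
  *-homo i j = begin
    fromℤ (sign i Sign.* sign j ◃ ∣ i ∣ ℕ.* ∣ j ∣)
      ≈⟨ ◃-homo (sign i Sign.* sign j) (∣ i ∣ ℕ.* ∣ j ∣) ⟩
    fromSign (sign i Sign.* sign j) * ((∣ i ∣ ℕ.* ∣ j ∣) × 1#)
      ≈⟨ *-cong (sign-*-homo (sign i) (sign j)) (×1-homo-* ∣ i ∣ ∣ j ∣) ⟩
    (fromSign (sign i) * fromSign (sign j)) * ((∣ i ∣ × 1#) * (∣ j ∣ × 1#))
      ≈⟨ interchange _ _ _ _ ⟩
    (fromSign (sign i) * (∣ i ∣ × 1#)) * (fromSign (sign j) * (∣ j ∣ × 1#))
      ≈⟨ *-cong (sign*abs i) (sign*abs j) ⟩
    fromℤ i * fromℤ j ∎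

  ℤ⟶R : +-*-rawRing -Raw-AlmostCommutative⟶ fromCommutativeRing R
  ℤ⟶R = record
    { ⟦_⟧ = fromℤ ; +-homo = +-homo ; *-homo = *-homo ; -‿homo = -‿homo
    ; 0-homo = refl ; 1-homo = refl }

  fromℤ-≟ : ∀ i j → Maybe (fromℤ i ≈ fromℤ j)
  fromℤ-≟ i j with i ≟ j
  ... | yes ≡.refl = just refl
  ... | no _       = nothing

  open import Algebra.Solver.Ring +-*-rawRing (fromCommutativeRing R) ℤ⟶R fromℤ-≟
    public using (Polynomial; con; solve; _:=_; _:+_; _:*_; _:-_; :-_; _:^_)

  :0 :1 : ∀ {n} → Polynomial n
  :0 = con (+ 0)
  :1 = con (+ 1)

module _ {c ℓ} (R : CommutativeRing c ℓ) where
  open import Algebra.Bundles using (Semiring)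
  open import Data.Nat.Base using (zero; suc; _∸_; s≤s)
    renaming (_+_ to _+ℕ_; _*_ to _*ℕ_; _≤_ to _≤ℕ_; _<_ to _<ℕ_)
  open import Data.Nat.Properties using (_≤?_; ≤-pred; m<n⇒m<1+n; ≰⇒>; n<1+n; *-zeroʳ)
  open import Relation.Nullary.Decidable using (yes; no)
  open import Relation.Binary.PropositionalEquality.Core as ≡ using (_≡_)
  open CommutativeRing R hiding (zero)
  open import Algebra.Definitions.RawSemiring (Semiring.rawSemiring semiring) using (_^_)
  open import Algebra.Properties.Ring ring using (x≈y⇒x∙y⁻¹≈ε)
  open import Algebra.Properties.Semiring.Exp semiring using (^-homo-*; ^-assocʳ)
  open import Algebra.Properties.CommutativeSemiring.Exp commutativeSemiring using (^-distrib-*)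
  open import Relation.Binary.Reasoning.Setoid setoid
  open IntegerCoefficientSolver R
  open ExponentArithmetic

  -- An identity that holds modulo a ≈ b is checked by the solver as x ≈ y + m * (a - b).
  ≈-modulo : ∀ {x y a b} m → x ≈ y + m * (a - b) → a ≈ b → x ≈ y
  ≈-modulo m x≈ a≈b = trans x≈ (trans (+-congˡ (m*[a-b]≈0 m a≈b)) (+-identityʳ _))
    where
    m*[a-b]≈0 : ∀ m {a b} → a ≈ b → m * (a - b) ≈ 0#
    m*[a-b]≈0 m a≈b = trans (*-congˡ (x≈y⇒x∙y⁻¹≈ε a≈b)) (zeroʳ m)

  ≈-modulo₂ : ∀ {x y a b a′ b′} m m′ →
    x ≈ y + (m * (a - b) + m′ * (a′ - b′)) → a ≈ b → a′ ≈ b′ → x ≈ y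
  ≈-modulo₂ {y = y} m m′ x≈ a≈b a′≈b′ =
    ≈-modulo m (≈-modulo m′ (trans x≈ (sym (+-assoc y _ _))) a′≈b′) a≈b

  ^-linear : ∀ x j k a b m → x ^ (j *ℕ a +ℕ k *ℕ b +ℕ m) ≈ (x ^ j) ^ a * (x ^ k) ^ b * x ^ m
  ^-linear x j k a b m = begin
    x ^ (j *ℕ a +ℕ k *ℕ b +ℕ m)         ≈⟨ ^-homo-* x (j *ℕ a +ℕ k *ℕ b) m ⟩
    x ^ (j *ℕ a +ℕ k *ℕ b) * x ^ m      ≈⟨ *-congʳ (^-homo-* x (j *ℕ a) (k *ℕ b)) ⟩
    x ^ (j *ℕ a) * x ^ (k *ℕ b) * x ^ m ≈⟨ *-congʳ (*-cong (^-assocʳ x j a) (^-assocʳ x k b)) ⟨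
    (x ^ j) ^ a * (x ^ k) ^ b * x ^ m   ∎

  sum : ℕ → (ℕ → Carrier) → Carrier
  sum = sumBelow R

  sum-cong : ∀ n {f g : ℕ → Carrier} → (∀ i → i <ℕ n → f i ≈ g i) → sum n f ≈ sum n g
  sum-cong zero    f≈g = refl
  sum-cong (suc n) f≈g = +-cong (sum-cong n (λ i i<n → f≈g i (m<n⇒m<1+n i<n))) (f≈g n (n<1+n n))

  sum-head : ∀ n (f : ℕ → Carrier) → sum (suc n) f ≈ f 0 + sum n (λ i → f (suc i))
  sum-head zero    f = trans (+-identityˡ _) (sym (+-identityʳ _))
  sum-head (suc n) f = trans (+-congʳ (sum-head n f)) (+-assoc _ _ _)

  sum-distrib-+ : ∀ n (f g : ℕ → Carrier) → sum n (λ i → f i + g i) ≈ sum n f + sum n g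
  sum-distrib-+ zero    f g = sym (+-identityʳ 0#)
  sum-distrib-+ (suc n) f g = trans (+-congʳ (sum-distrib-+ n f g))
    (solve 4 (λ F G x y → F :+ G :+ (x :+ y) := F :+ x :+ (G :+ y)) refl (sum n f) (sum n g) (f n) (g n))

  *-distribˡ-sum : ∀ n x (f : ℕ → Carrier) → x * sum n f ≈ sum n (λ i → x * f i)
  *-distribˡ-sum zero    x f = zeroʳ x
  *-distribˡ-sum (suc n) x f = trans (distribˡ x _ _) (+-congʳ (*-distribˡ-sum n x f))

  sum-linear : ∀ n (f g h t : ℕ → Carrier) γ δ →
    sum n (λ i → (f i - γ * g i - δ * h i) * t i)
      ≈ sum n (λ i → f i * t i) - γ * sum n (λ i → g i * t i) - δ * sum n (λ i → h i * t i)
  sum-linear zero    f g h t γ δ = solve 2 (λ γ δ → :0 := :0 :- γ :* :0 :- δ :* :0) refl γ δ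
  sum-linear (suc n) f g h t γ δ = trans (+-congʳ (sum-linear n f g h t γ δ))
    (solve 9 (λ F G H γ δ x y w τ →
                F :- γ :* G :- δ :* H :+ (x :- γ :* y :- δ :* w) :* τ
                  := F :+ x :* τ :- γ :* (G :+ y :* τ) :- δ :* (H :+ w :* τ))
           refl (sum n _) (sum n _) (sum n _) γ δ (f n) (g n) (h n) (t n))

  -- Coefficient sequences of power series: shift is multiplication by z, _⋆_ the Cauchy product.
  shift : (ℕ → Carrier) → ℕ → Carrier
  shift f zero    = 0#
  shift f (suc i) = f i

  shift-cong : ∀ {f g : ℕ → Carrier} → (∀ i → f i ≈ g i) → ∀ n → shift f n ≈ shift g n
  shift-cong f≈g zero    = refl
  shift-cong f≈g (suc n) = f≈g n

  _⋆_ : (ℕ → Carrier) → (ℕ → Carrier) → ℕ → Carrier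
  (f ⋆ g) n = sum (suc n) (λ i → f i * g (n ∸ i))

  shift-⋆ : ∀ f g n → (shift f ⋆ g) n ≈ shift (f ⋆ g) n
  shift-⋆ f g zero    = trans (+-identityˡ _) (zeroˡ _)
  shift-⋆ f g (suc n) = trans (sum-head (suc n) _) (trans (+-congʳ (zeroˡ _)) (+-identityˡ _))

  shift²-⋆ : ∀ f g n → (shift (shift f) ⋆ g) n ≈ shift (shift (f ⋆ g)) n
  shift²-⋆ f g n = trans (shift-⋆ (shift f) g n) (shift-cong (shift-⋆ f g) n)

  -- F (2 + k) = (1 - γ k z) F (1 + k) - δ k z² F k, read off coefficientwise.
  Recurrence : (γ δ : ℕ → Carrier) → (ℕ → ℕ → Carrier) → Set ℓ
  Recurrence γ δ F = ∀ k n →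
    F (suc (suc k)) n ≈ F (suc k) n - γ k * shift (F (suc k)) n - δ k * shift (shift (F k)) n

  ⋆-recurrence : ∀ {γ δ F} g → Recurrence γ δ F → Recurrence γ δ (λ h → F h ⋆ g)
  ⋆-recurrence {γ} {δ} {F} g rec k n = begin
    (F (suc (suc k)) ⋆ g) n
      ≈⟨ sum-cong (suc n) (λ i _ → *-congʳ (rec k i)) ⟩
    sum (suc n) (λ i → (F (suc k) i - γ k * shift (F (suc k)) i - δ k * shift (shift (F k)) i) * g (n ∸ i))
      ≈⟨ sum-linear (suc n) _ _ _ _ (γ k) (δ k) ⟩
    (F (suc k) ⋆ g) n - γ k * (shift (F (suc k)) ⋆ g) n - δ k * (shift (shift (F k)) ⋆ g) n
      ≈⟨ +-cong (+-congˡ (-‿cong (*-congˡ (shift-⋆ (F (suc k)) g n))))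
                (-‿cong (*-congˡ (shift²-⋆ (F k) g n))) ⟩
    (F (suc k) ⋆ g) n - γ k * shift (F (suc k) ⋆ g) n - δ k * shift (shift (F k ⋆ g)) n ∎

  module _ (z : Carrier) where
    evalBelow : (ℕ → Carrier) → ℕ → Carrier
    evalBelow f m = sum m (λ n → f n * z ^ n)

    evalBelow-shift : ∀ f m → evalBelow (shift f) (suc m) ≈ z * evalBelow f m
    evalBelow-shift f zero    = solve 1 (λ z → :0 :+ :0 :* :1 := z :* :0) refl z
    evalBelow-shift f (suc m) = trans (+-congʳ (evalBelow-shift f m))
      (solve 4 (λ z E y zᵐ → z :* E :+ y :* (z :* zᵐ) := z :* (E :+ y :* zᵐ)) refl z (evalBelow f m) (f m) (z ^ m))

    -- The recurrence survives truncation to degree < h because F (1 + k) has no term of degree 1 + k.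
    evalBelow-recurrence : ∀ {γ δ F} → Recurrence γ δ F → (∀ m → F (suc m) (suc m) ≈ 0#) → ∀ k →
      evalBelow (F (suc (suc k))) (suc (suc k))
        ≈ (1# - γ k * z) * evalBelow (F (suc k)) (suc k) - δ k * z ^ 2 * evalBelow (F k) k
    evalBelow-recurrence {γ} {δ} {F} rec diagonal k = begin
      evalBelow (F (suc (suc k))) (suc (suc k))
        ≈⟨ sum-cong (suc (suc k)) (λ n _ → *-congʳ (rec k n)) ⟩
      sum (suc (suc k)) (λ n → (F (suc k) n - γ k * shift (F (suc k)) n - δ k * shift (shift (F k)) n) * z ^ n)
        ≈⟨ sum-linear (suc (suc k)) _ _ _ _ (γ k) (δ k) ⟩
      evalBelow (F (suc k)) (suc (suc k)) - γ k * evalBelow (shift (F (suc k))) (suc (suc k))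
        - δ k * evalBelow (shift (shift (F k))) (suc (suc k))
        ≈⟨ +-cong (+-cong drop-top (-‿cong (*-congˡ (evalBelow-shift _ (suc k))))) (-‿cong (*-congˡ shift²)) ⟩
      E₁ - γ k * (z * E₁) - δ k * (z * (z * E₀))
        ≈⟨ solve 5 (λ z γ δ E₁ E₀ → E₁ :- γ :* (z :* E₁) :- δ :* (z :* (z :* E₀))
                                      := (:1 :- γ :* z) :* E₁ :- δ :* z :^ 2 :* E₀) refl z (γ k) (δ k) E₁ E₀ ⟩
      (1# - γ k * z) * E₁ - δ k * z ^ 2 * E₀ ∎
      where
      E₁ E₀ : Carrier
      E₁ = evalBelow (F (suc k)) (suc k)
      E₀ = evalBelow (F k) k
      drop-top : evalBelow (F (suc k)) (suc (suc k)) ≈ E₁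
      drop-top = trans (+-congˡ (trans (*-congʳ (diagonal k)) (zeroˡ _))) (+-identityʳ E₁)
      shift² : evalBelow (shift (shift (F k))) (suc (suc k)) ≈ z * (z * E₀)
      shift² = trans (evalBelow-shift _ (suc k)) (*-congˡ (evalBelow-shift _ k))

  module Gaussian (Q : Carrier) where
    [_,_] : ℕ → ℕ → Carrier
    [_,_] = qBinom R Q

    n<m⇒[n,m]≈0 : ∀ {n m} → n <ℕ m → [ n , m ] ≈ 0#
    n<m⇒[n,m]≈0 {zero}  {suc m} _         = refl
    n<m⇒[n,m]≈0 {suc n} {suc m} (s≤s n<m) = begin
      [ n , m ] + Q ^ suc m * [ n , suc m ]
        ≈⟨ +-cong (n<m⇒[n,m]≈0 n<m) (*-congˡ (n<m⇒[n,m]≈0 (m<n⇒m<1+n n<m))) ⟩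
      0# + Q ^ suc m * 0#  ≈⟨ +-identityˡ _ ⟩
      Q ^ suc m * 0#       ≈⟨ zeroʳ _ ⟩
      0#                   ∎

    -- The q-analogue of (i + 1) C(k, i + 1) = (k - i) C(k, i).
    [k,1+i]-ratio : ∀ k i → Q ^ i * (Q ^ suc i - 1#) * [ k , suc i ] ≈ (Q ^ k - Q ^ i) * [ k , i ]
    [k,1+i]-ratio zero    zero    = solve 1 (λ Q → :1 :* (Q :* :1 :- :1) :* :0 := (:1 :- :1) :* :1) refl Q
    [k,1+i]-ratio zero    (suc i) =
      solve 2 (λ Q Qⁱ⁺¹ → Qⁱ⁺¹ :* (Q :* Qⁱ⁺¹ :- :1) :* :0 := (:1 :- Qⁱ⁺¹) :* :0) refl Q (Q ^ suc i)
    [k,1+i]-ratio (suc k) zero    = ≈-modulo Q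
      (solve 3 (λ Q Qᵏ X → :1 :* (Q :* :1 :- :1) :* (:1 :+ Q :* :1 :* X)
                            := (Q :* Qᵏ :- :1) :* :1 :+ Q :* (:1 :* (Q :* :1 :- :1) :* X :- (Qᵏ :- :1) :* :1))
             refl Q (Q ^ k) [ k , 1 ])
      ([k,1+i]-ratio k zero)
    [k,1+i]-ratio (suc k) (suc i) = ≈-modulo₂ Q (Q * (Q * Q ^ i))
      (solve 6 (λ Q Qⁱ Qᵏ X₀ X₁ X₂ →
                 Q :* Qⁱ :* (Q :* (Q :* Qⁱ) :- :1) :* (X₁ :+ Q :* (Q :* Qⁱ) :* X₂)
                   := (Q :* Qᵏ :- Q :* Qⁱ) :* (X₀ :+ Q :* Qⁱ :* X₁)
                      :+ (Q :* (Qⁱ :* (Q :* Qⁱ :- :1) :* X₁ :- (Qᵏ :- Qⁱ) :* X₀)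
                          :+ Q :* (Q :* Qⁱ) :* (Q :* Qⁱ :* (Q :* (Q :* Qⁱ) :- :1) :* X₂ :- (Qᵏ :- Q :* Qⁱ) :* X₁)))
             refl Q (Q ^ i) (Q ^ k) [ k , i ] [ k , suc i ] [ k , suc (suc i) ])
      ([k,1+i]-ratio k i) ([k,1+i]-ratio k (suc i))

    -- Expanding both sides by the Pascal rule to [k, j], [k, 1+j], [k, 2+j] leaves a combination of two ratio identities.
    [2+k,2+j]-three-term : ∀ k j →
      [ suc (suc k) , suc (suc j) ] * (Q ^ suc j * Q ^ suc j * Q)
        ≈ Q ^ suc j * [ suc k , suc (suc j) ]
          + Q ^ suc j * (Q ^ suc (suc k) + Q ^ suc k - 1#) * [ suc k , suc j ]
          - Q ^ suc k * (Q ^ suc k - 1#) * [ k , j ]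
    [2+k,2+j]-three-term k j = ≈-modulo₂ (Q * Q * Q * Q ^ j + Q - Q * Q * Q ^ k) (Q * Q * Q ^ j * (Q * Q * Q ^ j + 1#))
      (solve 6 (λ Q Qʲ Qᵏ X₀ X₁ X₂ →
         (X₀ :+ Q :* Qʲ :* X₁ :+ Q :* (Q :* Qʲ) :* (X₁ :+ Q :* (Q :* Qʲ) :* X₂)) :* (Q :* Qʲ :* (Q :* Qʲ) :* Q)
           := Q :* Qʲ :* (X₁ :+ Q :* (Q :* Qʲ) :* X₂)
              :+ Q :* Qʲ :* (Q :* (Q :* Qᵏ) :+ Q :* Qᵏ :- :1) :* (X₀ :+ Q :* Qʲ :* X₁)
              :- Q :* Qᵏ :* (Q :* Qᵏ :- :1) :* X₀
              :+ ((Q :* Q :* Q :* Qʲ :+ Q :- Q :* Q :* Qᵏ) :* (Qʲ :* (Q :* Qʲ :- :1) :* X₁ :- (Qᵏ :- Qʲ) :* X₀)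
                  :+ Q :* Q :* Qʲ :* (Q :* Q :* Qʲ :+ :1) :* (Q :* Qʲ :* (Q :* (Q :* Qʲ) :- :1) :* X₂ :- (Qᵏ :- Q :* Qʲ) :* X₁)))
         refl Q (Q ^ j) (Q ^ k) [ k , j ] [ k , suc j ] [ k , suc (suc j) ])
      ([k,1+i]-ratio k j) ([k,1+i]-ratio k (suc j))

  module _ (q : Carrier) where
    Q : Carrier
    Q = q ^ 2

    open Gaussian Q

    q^[2n+r] : ∀ n r → q ^ (2 *ℕ n +ℕ r) ≈ Q ^ n * q ^ r
    q^[2n+r] n r = trans (^-homo-* q (2 *ℕ n) r) (*-congʳ (sym (^-assocʳ q 2 n)))

    q^-expand : ∀ {E} e j k a b m r → E ≡ e +ℕ (2 *ℕ (j *ℕ a +ℕ k *ℕ b +ℕ m) +ℕ r) →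
      q ^ E ≈ q ^ e * ((Q ^ j) ^ a * (Q ^ k) ^ b * Q ^ m * q ^ r)
    q^-expand {E} e j k a b m r E≡ = begin
      q ^ E                       ≡⟨ ≡.cong (q ^_) E≡ ⟩
      q ^ (e +ℕ (2 *ℕ n +ℕ r))   ≈⟨ ^-homo-* q e _ ⟩
      q ^ e * q ^ (2 *ℕ n +ℕ r)  ≈⟨ *-congˡ (q^[2n+r] n r) ⟩
      q ^ e * (Q ^ n * q ^ r)     ≈⟨ *-congˡ (*-congʳ (^-linear Q j k a b m)) ⟩
      q ^ e * ((Q ^ j) ^ a * (Q ^ k) ^ b * Q ^ m * q ^ r) ∎
      where
      n : ℕ
      n = j *ℕ a +ℕ k *ℕ b +ℕ m

    γ δ : ℕ → Carrier
    γ k = cCoef R q (suc (suc k))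
    δ k = αCoef R q (suc (suc k))

    γ-expand : ∀ k → γ k ≈ Q ^ k * q ^ 1 * (Q ^ k * q ^ 4 + Q ^ k * q ^ 2 - 1#)
    γ-expand k = *-cong (q^[2n+r] k 1) (+-congʳ (+-cong (q^[2n+r] k 4) (q^[2n+r] k 2)))

    δ-expand : ∀ k → δ k ≈ (Q ^ k) ^ 3 * q ^ 2 * (Q ^ k * q ^ 2 - 1#)
    δ-expand k = *-cong q^[6k+2] (+-congʳ (q^[2n+r] k 2))
      where
      q^[6k+2] : q ^ (6 *ℕ k +ℕ 2) ≈ (Q ^ k) ^ 3 * q ^ 2
      q^[6k+2] = trans (reflexive (≡.cong (q ^_) (6k+2≡2[3k]+2 k)))
                   (trans (q^[2n+r] (k *ℕ 3) 2) (*-congʳ (sym (^-assocʳ Q k 3))))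

    B : ℕ → ℕ → Carrier
    B h i = [ h , i ] * q ^ ((2 *ℕ h ∸ 1) *ℕ i) * (- 1#) ^ i

    θ : ℕ → Carrier
    θ m = q ^ (m *ℕ m)

    B-zero : ∀ h → B h 0 ≈ 1#
    B-zero h = trans (*-congʳ (*-congˡ (reflexive (≡.cong (q ^_) (*-zeroʳ (2 *ℕ h ∸ 1))))))
                 (trans (*-identityʳ _) (*-identityˡ _))

    B-one : ∀ k → B (suc k) 1 ≈ [ suc k , 1 ] * (Q ^ k * q ^ 1) * (- 1#) ^ 1
    B-one k = *-congʳ (*-congˡ (trans (reflexive (≡.cong (q ^_) ([2[1+k]∸1]*1≡2k+1 k))) (q^[2n+r] k 1)))

    h<i⇒B≈0 : ∀ {h i} → h <ℕ i → B h i ≈ 0#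
    h<i⇒B≈0 h<i = trans (*-congʳ (*-congʳ (n<m⇒[n,m]≈0 h<i))) (trans (*-congʳ (zeroˡ _)) (zeroˡ _))

    B-recurrence₀ : ∀ k → B (suc (suc k)) 0 ≈ B (suc k) 0 - γ k * 0# - δ k * 0#
    B-recurrence₀ k = begin
      B (suc (suc k)) 0                  ≈⟨ B-zero (suc (suc k)) ⟩
      1#                                 ≈⟨ solve 2 (λ γ δ → :1 := :1 :- γ :* :0 :- δ :* :0) refl (γ k) (δ k) ⟩
      1# - γ k * 0# - δ k * 0#           ≈⟨ +-congʳ (+-congʳ (B-zero (suc k))) ⟨
      B (suc k) 0 - γ k * 0# - δ k * 0#  ∎

    B-recurrence₁ : ∀ k → B (suc (suc k)) 1 ≈ B (suc k) 1 - γ k * B (suc k) 0 - δ k * 0#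
    B-recurrence₁ k = begin
      B (suc (suc k)) 1
        ≈⟨ B-one (suc k) ⟩
      [ suc (suc k) , 1 ] * (Q ^ suc k * q ^ 1) * (- 1#) ^ 1
        ≈⟨ ≈-modulo (- (q * Q ^ k * (Q + 1#)))
             (solve 4 (λ q Qᵏ X d → let Q = q :^ 2 in
                (:1 :+ Q :* :1 :* X) :* (Q :* Qᵏ :* q :^ 1) :* (:- :1 :* :1)
                  := X :* (Qᵏ :* q :^ 1) :* (:- :1 :* :1)
                     :- Qᵏ :* q :^ 1 :* (Qᵏ :* q :^ 4 :+ Qᵏ :* q :^ 2 :- :1) :* :1
                     :- d :* :0
                     :+ (:- (q :* Qᵏ :* (Q :+ :1))) :* (:1 :* (Q :* :1 :- :1) :* X :- (Q :* Qᵏ :- :1) :* :1))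
                refl q (Q ^ k) [ suc k , 1 ] (δ k))
             ([k,1+i]-ratio (suc k) 0) ⟩
      [ suc k , 1 ] * (Q ^ k * q ^ 1) * (- 1#) ^ 1
        - Q ^ k * q ^ 1 * (Q ^ k * q ^ 4 + Q ^ k * q ^ 2 - 1#) * 1# - δ k * 0#
        ≈⟨ +-congʳ (+-cong (B-one k) (-‿cong (*-cong (γ-expand k) (B-zero (suc k))))) ⟨
      B (suc k) 1 - γ k * B (suc k) 0 - δ k * 0# ∎

    -- Both sides carry the factor q^((2k ∸ 1) j) (-1)^j Q^(2k); dividing it out leaves the three-term identity.
    B-recurrence-≤ : ∀ {j k} → j ≤ℕ k →
      B (suc (suc k)) (suc (suc j)) ≈ B (suc k) (suc (suc j)) - γ k * B (suc k) (suc j) - δ k * B k j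
    B-recurrence-≤ {j} {k} j≤k = begin
      B (suc (suc k)) (suc (suc j))
        ≈⟨ *-congʳ (*-congˡ (q^-expand e j k 2 2 3 0 (exponent₂₂ j≤k))) ⟩
      [ suc (suc k) , suc (suc j) ] * (w * ((Qʲ ^ 2 * Qᵏ ^ 2 * Q ^ 3) * q ^ 0)) * (- 1#) ^ suc (suc j)
        ≈⟨ ≈-modulo (w * s * Qᵏ * Qᵏ)
             (solve 9 (λ q Qʲ Qᵏ w s X₂₂ X₁₂ X₁₁ X₀₀ → let Q = q :^ 2 in
                X₂₂ :* (w :* ((Qʲ :^ 2 :* Qᵏ :^ 2 :* Q :^ 3) :* q :^ 0)) :* (:- :1 :* (:- :1 :* s))
                  := X₁₂ :* (w :* ((Qʲ :^ 1 :* Qᵏ :^ 2 :* Q :^ 1) :* q :^ 0)) :* (:- :1 :* (:- :1 :* s))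
                     :- Qᵏ :* q :^ 1 :* (Qᵏ :* q :^ 4 :+ Qᵏ :* q :^ 2 :- :1)
                        :* (X₁₁ :* (w :* ((Qʲ :^ 1 :* Qᵏ :^ 1 :* Q :^ 0) :* q :^ 1)) :* (:- :1 :* s))
                     :- Qᵏ :^ 3 :* q :^ 2 :* (Qᵏ :* q :^ 2 :- :1) :* (X₀₀ :* w :* s)
                     :+ w :* s :* Qᵏ :* Qᵏ
                        :* (X₂₂ :* (Q :* Qʲ :* (Q :* Qʲ) :* Q)
                            :- (Q :* Qʲ :* X₁₂ :+ Q :* Qʲ :* (Q :* (Q :* Qᵏ) :+ Q :* Qᵏ :- :1) :* X₁₁
                                :- Q :* Qᵏ :* (Q :* Qᵏ :- :1) :* X₀₀)))
                refl q Qʲ Qᵏ w s [ suc (suc k) , suc (suc j) ] [ suc k , suc (suc j) ] [ suc k , suc j ] [ k , j ])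
             ([2+k,2+j]-three-term k j) ⟩
      [ suc k , suc (suc j) ] * (w * ((Qʲ ^ 1 * Qᵏ ^ 2 * Q ^ 1) * q ^ 0)) * (- 1#) ^ suc (suc j)
        - Qᵏ * q ^ 1 * (Qᵏ * q ^ 4 + Qᵏ * q ^ 2 - 1#)
          * ([ suc k , suc j ] * (w * ((Qʲ ^ 1 * Qᵏ ^ 1 * Q ^ 0) * q ^ 1)) * (- 1#) ^ suc j)
        - Qᵏ ^ 3 * q ^ 2 * (Qᵏ * q ^ 2 - 1#) * B k j
        ≈⟨ +-cong (+-cong (*-congʳ (*-congˡ (q^-expand e j k 1 2 1 0 (exponent₁₂ j≤k))))
                          (-‿cong (*-cong (γ-expand k) (*-congʳ (*-congˡ (q^-expand e j k 1 1 0 1 (exponent₁₁ j≤k)))))))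
                  (-‿cong (*-congʳ (δ-expand k))) ⟨
      B (suc k) (suc (suc j)) - γ k * B (suc k) (suc j) - δ k * B k j ∎
      where
      e : ℕ
      e = (2 *ℕ k ∸ 1) *ℕ j
      w s Qʲ Qᵏ : Carrier
      w = q ^ e
      s = (- 1#) ^ j
      Qʲ = Q ^ j
      Qᵏ = Q ^ k

    B-recurrence : Recurrence γ δ B
    B-recurrence k zero             = B-recurrence₀ k
    B-recurrence k (suc zero)       = B-recurrence₁ k
    B-recurrence k (suc (suc j)) with j ≤? k
    ... | yes j≤k = B-recurrence-≤ j≤k
    ... | no  j≰k = begin
      B (suc (suc k)) (suc (suc j))             ≈⟨ h<i⇒B≈0 (s≤s (s≤s k<j)) ⟩
      0#                                        ≈⟨ solve 2 (λ γ δ → :0 := :0 :- γ :* :0 :- δ :* :0) refl (γ k) (δ k) ⟩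
      0# - γ k * 0# - δ k * 0#                  ≈⟨ +-cong (+-cong (h<i⇒B≈0 (s≤s (m<n⇒m<1+n k<j)))
                                                                   (-‿cong (*-congˡ (h<i⇒B≈0 (s≤s k<j)))))
                                                           (-‿cong (*-congˡ (h<i⇒B≈0 k<j))) ⟨
      B (suc k) (suc (suc j)) - γ k * B (suc k) (suc j) - δ k * B k j ∎
      where
      k<j : k <ℕ j
      k<j = ≰⇒> j≰k

    qBinomialTerm : ℕ → Carrier → ℕ → Carrier
    qBinomialTerm n x i = [ n , i ] * q ^ (i *ℕ (i ∸ 1)) * x ^ i

    -- By Rothe's q-binomial theorem this is ∏_{j<n} (1 + Q^j x); we only need the recursion in n.
    qBinomialSum : ℕ → Carrier → Carrier
    qBinomialSum n x = sum (suc n) (qBinomialTerm n x)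

    qBinomialTerm-zero : ∀ n x → qBinomialTerm n x 0 ≈ 1#
    qBinomialTerm-zero n x = trans (*-identityʳ _) (*-identityʳ _)

    qBinomialTerm-suc : ∀ n x i →
      qBinomialTerm (suc n) x (suc i) ≈ x * qBinomialTerm n (Q * x) i + qBinomialTerm n (Q * x) (suc i)
    qBinomialTerm-suc n x i = begin
      qBinomialTerm (suc n) x (suc i)
        ≈⟨ *-congʳ (*-congˡ q^[[1+i]i]) ⟩
      ([ n , i ] + Q ^ suc i * [ n , suc i ]) * (e * Q ^ i) * (x * x ^ i)
        ≈⟨ solve 7 (λ q X₀ X₁ e Qⁱ xⁱ x → let Q = q :^ 2 in
                      (X₀ :+ Q :* Qⁱ :* X₁) :* (e :* Qⁱ) :* (x :* xⁱ)
                        := x :* (X₀ :* e :* (Qⁱ :* xⁱ)) :+ X₁ :* (e :* Qⁱ) :* (Q :* x :* (Qⁱ :* xⁱ)))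
                 refl q [ n , i ] [ n , suc i ] e (Q ^ i) (x ^ i) x ⟩
      x * ([ n , i ] * e * (Q ^ i * x ^ i)) + [ n , suc i ] * (e * Q ^ i) * (Q * x * (Q ^ i * x ^ i))
        ≈⟨ +-cong (*-congˡ (*-congˡ (^-distrib-* Q x i)))
                  (*-cong (*-congˡ q^[[1+i]i]) (*-congˡ (^-distrib-* Q x i))) ⟨
      x * qBinomialTerm n (Q * x) i + qBinomialTerm n (Q * x) (suc i) ∎
      where
      e : Carrier
      e = q ^ (i *ℕ (i ∸ 1))
      q^[[1+i]i] : q ^ (suc i *ℕ i) ≈ e * Q ^ i
      q^[[1+i]i] = trans (reflexive (≡.cong (q ^_) ([1+i]i≡i[i∸1]+2i i)))
                     (trans (^-homo-* q (i *ℕ (i ∸ 1)) (2 *ℕ i)) (*-congˡ (sym (^-assocʳ q 2 i))))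

    qBinomialSum-suc : ∀ n x → qBinomialSum (suc n) x ≈ (1# + x) * qBinomialSum n (Q * x)
    qBinomialSum-suc n x = begin
      qBinomialSum (suc n) x
        ≈⟨ sum-head (suc n) _ ⟩
      qBinomialTerm (suc n) x 0 + sum (suc n) (λ i → qBinomialTerm (suc n) x (suc i))
        ≈⟨ +-cong (qBinomialTerm-zero (suc n) x) (sum-cong (suc n) (λ i _ → qBinomialTerm-suc n x i)) ⟩
      1# + sum (suc n) (λ i → x * t i + t (suc i))
        ≈⟨ +-congˡ (trans (sum-distrib-+ (suc n) _ _) (+-congʳ (sym (*-distribˡ-sum (suc n) x t)))) ⟩
      1# + (x * S + T)
        ≈⟨ solve 3 (λ x S T → :1 :+ (x :* S :+ T) := x :* S :+ (:1 :+ T)) refl x S T ⟩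
      x * S + (1# + T)
        ≈⟨ +-congˡ (trans (+-congʳ (sym (qBinomialTerm-zero n (Q * x)))) (sym (sum-head (suc n) t))) ⟩
      x * S + (S + t (suc n))
        ≈⟨ +-congˡ (trans (+-congˡ top-vanishes) (+-identityʳ S)) ⟩
      x * S + S
        ≈⟨ solve 2 (λ x S → x :* S :+ S := (:1 :+ x) :* S) refl x S ⟩
      (1# + x) * S ∎
      where
      t : ℕ → Carrier
      t = qBinomialTerm n (Q * x)
      S T : Carrier
      S = qBinomialSum n (Q * x)
      T = sum (suc n) (λ i → t (suc i))
      top-vanishes : t (suc n) ≈ 0#
      top-vanishes = trans (*-congʳ (*-congʳ (n<m⇒[n,m]≈0 (n<1+n n)))) (trans (*-congʳ (zeroˡ _)) (zeroˡ _))

    ⋆θ-diagonal : ∀ m → (B (suc m) ⋆ θ) (suc m) ≈ 0#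
    ⋆θ-diagonal m = begin
      (B n ⋆ θ) n
        ≈⟨ sum-cong (suc n) (λ i i<1+n → term≈ (≤-pred i<1+n)) ⟩
      sum (suc n) (λ i → q ^ (n *ℕ n) * qBinomialTerm n (- 1#) i)
        ≈⟨ *-distribˡ-sum (suc n) _ _ ⟨
      q ^ (n *ℕ n) * qBinomialSum n (- 1#)
        ≈⟨ *-congˡ (qBinomialSum-suc m (- 1#)) ⟩
      q ^ (n *ℕ n) * ((1# - 1#) * qBinomialSum m (Q * - 1#))
        ≈⟨ *-congˡ (trans (*-congʳ (-‿inverseʳ 1#)) (zeroˡ _)) ⟩
      q ^ (n *ℕ n) * 0#
        ≈⟨ zeroʳ _ ⟩
      0# ∎
      where
      n : ℕ
      n = suc m
      term≈ : ∀ {i} → i ≤ℕ n → B n i * θ (n ∸ i) ≈ q ^ (n *ℕ n) * qBinomialTerm n (- 1#) i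
      term≈ {i} i≤n = ≈-modulo ([ n , i ] * (- 1#) ^ i)
        (solve 6 (λ X u v s N e → X :* u :* s :* v := N :* (X :* e :* s) :+ X :* s :* (u :* v :- N :* e))
           refl [ n , i ] (q ^ ((2 *ℕ n ∸ 1) *ℕ i)) (θ (n ∸ i)) ((- 1#) ^ i) (q ^ (n *ℕ n)) (q ^ (i *ℕ (i ∸ 1))))
        (begin
          q ^ ((2 *ℕ n ∸ 1) *ℕ i) * q ^ ((n ∸ i) *ℕ (n ∸ i))
            ≈⟨ ^-homo-* q ((2 *ℕ n ∸ 1) *ℕ i) ((n ∸ i) *ℕ (n ∸ i)) ⟨
          q ^ ((2 *ℕ n ∸ 1) *ℕ i +ℕ (n ∸ i) *ℕ (n ∸ i))
            ≡⟨ ≡.cong (q ^_) (diagonal-exponent i≤n) ⟩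
          q ^ (n *ℕ n +ℕ i *ℕ (i ∸ 1))
            ≈⟨ ^-homo-* q (n *ℕ n) (i *ℕ (i ∸ 1)) ⟩
          q ^ (n *ℕ n) * q ^ (i *ℕ (i ∸ 1)) ∎)

  P≈truncation : ∀ q z h → P R q z h ≈ evalBelow z (B q h ⋆ θ q) h
  P≈truncation q z zero          = refl
  P≈truncation q z (suc zero)    = begin
    1#                             ≈⟨ B-zero q 1 ⟨
    B q 1 0                        ≈⟨ solve 1 (λ b → b := :0 :+ (:0 :+ b :* :1) :* :1) refl (B q 1 0) ⟩
    0# + (0# + B q 1 0 * 1#) * 1#  ∎
  P≈truncation q z (suc (suc k)) = begin
    P R q z (suc (suc k))
      ≈⟨ +-cong (*-congˡ (P≈truncation q z (suc k))) (-‿cong (*-congˡ (P≈truncation q z k))) ⟩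
    (1# - γ q k * z) * evalBelow z (B q (suc k) ⋆ θ q) (suc k) - δ q k * z ^ 2 * evalBelow z (B q k ⋆ θ q) k
      ≈⟨ evalBelow-recurrence z (⋆-recurrence (θ q) (B-recurrence q)) (⋆θ-diagonal q) k ⟨
    evalBelow z (B q (suc (suc k)) ⋆ θ q) (suc (suc k)) ∎

mainTheorem3 : ∀ {c ℓ} (R : CommutativeRing c ℓ) (q z : CommutativeRing.Carrier R)
    → ¬ (CommutativeRing._≈_ R q (CommutativeRing.0# R))
    → ¬ (CommutativeRing._≈_ R z (CommutativeRing.0# R))
    → (h : ℕ) → CommutativeRing._≈_ R (P R q z h) (rhs R q z h)
mainTheorem3 R q z _ _ = P≈truncation R q z
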